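{- The axiom schema $\Box(\Box\varphi\to\psi)\vee\Box(\Box\psi\to\varphi)$ is not valid over the class of temporal here-and-there models: there are formulas $\varphi,\psi$ (indeed distinct propositional variables $p,q$) and a world of a here-and-there model at which $\Box(\Box\varphi\to\psi)\vee\Box(\Box\psi\to\varphi)$ fails.
   Context: Formulas are built from propositional variables, $\bot,\wedge,\vee,\to,\bigcirc,\Diamond,\Box$. A model is $(W,\preccurlyeq,S,V)$ where $\preccurlyeq$ is a partial order on $W\ne\emptyset$, $S:W\to W$ satisfies $w\preccurlyeq v\Rightarrow S(w)\preccurlyeq S(v)$, and $V$ assigns each world a set of variables, monotone along $\preccurlyeq$. Satisfaction: $w\models p$ iff $p\in V(w)$; $w\not\models\bot$; $\wedge,\vee$ classical; $w\models\varphi\to\psi$ iff for all $v\succcurlyeq w$, $v\models\varphi$ implies $v\models\psi$; $w\models\bigcirc\varphi$ iff $S(w)\models\varphi$; $w\models\Diamond\varphi$ iff $\exists k\ge0$, $S^k(w)\models\varphi$; $w\models\Box\varphi$ iff $\forall k\ge0$, $S^k(w)\models\varphi$. A temporal here-and-there model is a model with $W=T\times\{0,1\}$ for some set $T$ and a function $f:T\to T$ such that $(t,i)\preccurlyeq(s,j)$ iff $t=s$ and $i\le j$, and $S(t,i)=(f(t),i)$. -}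

module Defs where

open import Data.Nat using (ℕ; zero; suc; _≤_)
open import Data.Fin using (Fin)
open import Data.Product using (_×_; _,_; Σ; ∃)
open import Data.Sum using (_⊎_)
open import Data.Empty using (⊥)
open import Data.Unit using (⊤)
open import Relation.Binary.PropositionalEquality using (_≡_)
open import Relation.Binary.Structures using (IsPartialOrder)
open import Relation.Binary.Core using (Rel)
open import Function using (_∘_; id)

Var : Set
Var = ℕ

infixr 4 _⇒_
infixr 5 _∨_
infixr 6 _∧_

data Formula : Set where
  var : Var → Formula
  ⊥f  : Formula
  _∧_ : Formula → Formula → Formula
  _∨_ : Formula → Formula → Formula
  _⇒_ : Formula → Formula → Formula
  ○   : Formula → Formula
  ◇   : Formula → Formula
  □   : Formula → Formula

iter : {A : Set} → ℕ → (A → A) → A → A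
iter zero    f = id
iter (suc k) f = f ∘ iter k f

record Model : Set₁ where
  field
    W        : Set
    inhabited : W
    _≼_      : Rel W _
    isPO     : IsPartialOrder _≡_ _≼_
    S        : W → W
    S-mono   : ∀ {w v} → w ≼ v → S w ≼ S v
    V        : W → Var → Set      -- V w p  means  p ∈ V(w)
    V-mono   : ∀ {w v p} → w ≼ v → V w p → V v p

_,_⊨_ : (M : Model) → Model.W M → Formula → Set
M , w ⊨ var p   = Model.V M w p
M , w ⊨ ⊥f      = ⊥
M , w ⊨ (φ ∧ ψ) = (M , w ⊨ φ) × (M , w ⊨ ψ)
M , w ⊨ (φ ∨ ψ) = (M , w ⊨ φ) ⊎ (M , w ⊨ ψ)
M , w ⊨ (φ ⇒ ψ) = ∀ v → Model._≼_ M w v → M , v ⊨ φ → M , v ⊨ ψ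
M , w ⊨ ○ φ     = M , Model.S M w ⊨ φ
M , w ⊨ ◇ φ     = Σ ℕ λ k → M , iter k (Model.S M) w ⊨ φ
M , w ⊨ □ φ     = ∀ (k : ℕ) → M , iter k (Model.S M) w ⊨ φ

-- Temporal here-and-there models: W = T × {0,1}, (t,i) ≼ (s,j) iff t = s and i ≤ j,
-- S (t,i) = (f t , i), for some set T and function f : T → T.
-- {0,1} is represented by Fin 2, compared via the order on ℕ (through toℕ).
open import Data.Fin using (toℕ)

HTRel : (T : Set) → Rel (T × Fin 2) _
HTRel T (t , i) (s , j) = (t ≡ s) × (toℕ i ≤ toℕ j)

IsHTModel : Model → Set₁
IsHTModel M =
  Σ Set λ T → Σ (T → T) λ f →
  Σ (Model.W M ≡ (T × Fin 2)) λ { _≡_.refl →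
    (∀ w v → Model._≼_ M w v → HTRel T w v) ×
    (∀ w v → HTRel T w v → Model._≼_ M w v) ×
    (∀ (t : T) (i : Fin 2) → Model.S M (t , i) ≡ (f t , i)) }

module Submission where

-- The countermodel has time line T = Bool with successor the constant
-- map to true, so false is an initial moment and true a fixed point.  The
-- variable p (= 0) holds exactly at the "there" worlds (t , 1), and q (= 1)
-- holds exactly at the worlds over time true.  At w = (false , 0):
--   * the first disjunct fails at step 0: the "there" world (false , 1) above w
--     satisfies □p but not q;
--   * the second disjunct fails at step 1: the world (true , 0) satisfies □q
--     (time stays at true forever) but not p.
-- The file first packages any T, f and monotone valuation into a here-and-there
-- model (with its iterates computed), then gives a general refutation criterion
-- for □(□φ → ψ), builds the countermodel, and derives the theorem.

open import Defs
open import Data.Nat using (ℕ; zero; suc; _≤_; z≤n; s≤s)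
open import Data.Nat.Properties using (≤-refl; ≤-trans; ≤-antisym)
open import Data.Bool using (Bool; true; false)
open import Data.Fin using (Fin; toℕ) renaming (zero to here; suc to next)
open import Data.Fin.Properties using (toℕ-injective)
open import Data.Product using (Σ; _×_; _,_)
open import Data.Sum using (inj₁; inj₂)
open import Data.Empty using (⊥)
open import Relation.Nullary using (¬_)
open import Relation.Binary.PropositionalEquality
  using (_≡_; _≢_; refl; sym; cong; cong₂; subst; isEquivalence)
open import Relation.Binary.Structures using (IsPartialOrder)

htRel-isPartialOrder : (T : Set) → IsPartialOrder _≡_ (HTRel T)
htRel-isPartialOrder T = record
  { isPreorder = record
      { isEquivalence = isEquivalence
      ; reflexive     = λ { refl → refl , ≤-refl }
      ; trans         = λ { (refl , i≤j) (refl , j≤k) → refl , ≤-trans i≤j j≤k }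
      }
  ; antisym = λ { (refl , i≤j) (_ , j≤i) → cong₂ _,_ refl (toℕ-injective (≤-antisym i≤j j≤i)) }
  }

htStep : {T : Set} → (T → T) → T × Fin 2 → T × Fin 2
htStep f (t , i) = f t , i

iter-htStep : {T : Set} (f : T → T) (k : ℕ) (t : T) (i : Fin 2) →
              iter k (htStep f) (t , i) ≡ (iter k f t , i)
iter-htStep f zero    t i = refl
iter-htStep f (suc k) t i = cong (htStep f) (iter-htStep f k t i)

htModel : (T : Set) → T → (f : T → T) → (V : T × Fin 2 → Var → Set) →
          (∀ {w v p} → HTRel T w v → V w p → V v p) → Model
htModel T t₀ f V V-mono = record
  { W         = T × Fin 2
  ; inhabited = t₀ , here
  ; _≼_       = HTRel T
  ; isPO      = htRel-isPartialOrder T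
  ; S         = htStep f
  ; S-mono    = λ { (refl , i≤j) → refl , i≤j }
  ; V         = V
  ; V-mono    = V-mono
  }

htModel-isHT : (T : Set) (t₀ : T) (f : T → T) (V : T × Fin 2 → Var → Set)
               (V-mono : ∀ {w v p} → HTRel T w v → V w p → V v p) →
               IsHTModel (htModel T t₀ f V V-mono)
htModel-isHT T t₀ f V V-mono =
  T , f , refl , (λ _ _ w≼v → w≼v) , (λ _ _ w≼v → w≼v) , (λ _ _ → refl)

refute-□□⇒ : (M : Model) (w : Model.W M) (φ ψ : Formula) (k : ℕ) (v : Model.W M) →
             Model._≼_ M (iter k (Model.S M) w) v → M , v ⊨ □ φ → ¬ (M , v ⊨ ψ) →
             ¬ (M , w ⊨ □ (□ φ ⇒ ψ))
refute-□□⇒ M w φ ψ k v w≼v v⊨□φ v⊭ψ w⊨ = v⊭ψ (w⊨ k v w≼v v⊨□φ)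

toTrue : Bool → Bool
toTrue _ = true

iter-toTrue : (k : ℕ) → iter k toTrue true ≡ true
iter-toTrue zero    = refl
iter-toTrue (suc k) = refl

val : Bool × Fin 2 → Var → Set
val (t , i) zero          = 1 ≤ toℕ i
val (t , i) (suc zero)    = t ≡ true
val (t , i) (suc (suc _)) = ⊥

val-mono : ∀ {w v p} → HTRel Bool w v → val w p → val v p
val-mono {p = zero}          (refl , i≤j) 1≤i = ≤-trans 1≤i i≤j
val-mono {p = suc zero}      (refl , _)   t≡true = t≡true
val-mono {p = suc (suc _)}   (refl , _)   ()

counterModel : Model
counterModel = htModel Bool false toTrue val val-mono

there⊨□p : (t : Bool) → counterModel , (t , next here) ⊨ □ (var 0)
there⊨□p t k = subst (λ w → val w 0) (sym (iter-htStep toTrue k t (next here))) (s≤s z≤n)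

true⊨□q : (i : Fin 2) → counterModel , (true , i) ⊨ □ (var 1)
true⊨□q i k = subst (λ w → val w 1) (sym (iter-htStep toTrue k true i)) (iter-toTrue k)

mainTheorem8 : Σ ℕ λ p → Σ ℕ λ q → (p ≢ q) ×
    Σ Model λ M → IsHTModel M × Σ (Model.W M) λ w →
    ¬ (M , w ⊨ (□ (□ (var p) ⇒ var q) ∨ □ (□ (var q) ⇒ var p)))
mainTheorem8 =
  0 , 1 , (λ ()) , counterModel , htModel-isHT Bool false toTrue val val-mono ,
  (false , here) , refute
  where
  refute : ¬ (counterModel , (false , here) ⊨
                (□ (□ (var 0) ⇒ var 1) ∨ □ (□ (var 1) ⇒ var 0)))
  -- At step 0, (false , 1) satisfies □p, but q fails there since false ≢ true.
  refute (inj₁ first) = refute-□□⇒ counterModel (false , here) (var 0) (var 1)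
    0 (false , next here) (refl , z≤n) (there⊨□p false) (λ ()) first
  -- At step 1, (true , 0) satisfies □q, but p fails there since its layer is 0.
  refute (inj₂ second) = refute-□□⇒ counterModel (false , here) (var 1) (var 0)
    1 (true , here) (refl , z≤n) (true⊨□q here) (λ ()) second
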